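{- The map $m\mapsto(\pi(m),\mu(m)')$ is a bijection between the set of all monomials in $\mathbf{Q}[x_1,\dots,x_n]$ and the set of all pairs $(\pi,\tilde\mu)$ with $\pi\in S_n$ and $\tilde\mu$ a partition with at most $n$ parts.
   Context: For a monomial $m=\prod x_i^{p_i}$: its index permutation $\pi(m)\in S_n$ is the unique $\pi$ with $p_{\pi(i)}\ge p_{\pi(i+1)}$ and $\pi(i)<\pi(i+1)$ whenever $p_{\pi(i)}=p_{\pi(i+1)}$. With $\pi=\pi(m)$, $d_i(\pi)=|\{j\ge i:\pi(j)>\pi(j+1)\}|$, and $\mu(m)$ is the partition conjugate to $(p_{\pi(i)}-d_i(\pi))_{i=1}^n$, so $\mu(m)'=(p_{\pi(i)}-d_i(\pi))_{i=1}^n$ (a weakly decreasing sequence of nonnegative integers). -}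

module Defs where

open import Data.Nat using (ℕ; zero; suc; _∸_; _≤_; _<ᵇ_; _≤?_)
open import Data.Fin using (Fin; zero; suc; toℕ; _<_)
open import Data.Fin.Permutation public using (Permutation′; _⟨$⟩ʳ_)
open import Data.Vec using (Vec; lookup; tabulate)
open import Data.List using (List; map; filter; allFin)
open import Data.Nat.ListAction using (sum)
open import Data.Maybe using (Maybe; just; nothing)
import Data.Maybe as Maybe
open import Data.Bool using (if_then_else_)
open import Relation.Binary.PropositionalEquality using (_≡_)
open import Data.Product using (_×_)

-- A monomial x₁^p₁ ⋯ xₙ^pₙ in Q[x₁,…,xₙ] is identified with its exponent
-- vector (p₁,…,pₙ) (0-indexed positions 0,…,n-1).
Monomial : ℕ → Set
Monomial n = Vec ℕ n

Sym : ℕ → Set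
Sym n = Permutation′ n

nextF : ∀ {n} → Fin n → Maybe (Fin n)
nextF {suc zero} zero = nothing
nextF {suc (suc n)} zero = just (suc zero)
nextF {suc (suc n)} (suc i) = Maybe.map suc (nextF {suc n} i)

IsIndexPerm : ∀ {n} → Monomial n → Sym n → Set
IsIndexPerm {n} p π = ∀ (i j : Fin n) → nextF i ≡ just j →
  (lookup p (π ⟨$⟩ʳ j) ≤ lookup p (π ⟨$⟩ʳ i)) ×
  (lookup p (π ⟨$⟩ʳ i) ≡ lookup p (π ⟨$⟩ʳ j) → (π ⟨$⟩ʳ i) < (π ⟨$⟩ʳ j))

descent : ∀ {n} → Sym n → Fin n → ℕ
descent π j with nextF j
... | nothing = 0
... | just k = if toℕ (π ⟨$⟩ʳ k) <ᵇ toℕ (π ⟨$⟩ʳ j) then 1 else 0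

d : ∀ {n} → Sym n → Fin n → ℕ
d {n} π i = sum (map (descent π) (filter (λ j → toℕ i ≤? toℕ j) (allFin n)))

conjMu : ∀ {n} → Monomial n → Sym n → Vec ℕ n
conjMu p π = tabulate (λ i → lookup p (π ⟨$⟩ʳ i) ∸ d π i)

-- A partition with at most n parts, written as a weakly decreasing
-- length-n vector of naturals (padded by zeros).
WeaklyDecreasing : ∀ {n} → Vec ℕ n → Set
WeaklyDecreasing {n} v = ∀ (i j : Fin n) → toℕ i ≤ toℕ j → lookup v j ≤ lookup v i

{-# OPTIONS --safe #-}
module Submission where

open import Defs
open import Algebra.Properties.CommutativeSemigroup using (x∙yz≈y∙xz)
open import Data.Bool using (true; false; if_then_else_)
open import Data.Fin using (Fin; zero; suc; toℕ)
import Data.Fin as F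
open import Data.Fin.Permutation
  using (Permutation′; permutation; _⟨$⟩ˡ_; inverseˡ; inverseʳ; flip; _∘ₚ_; _≈_)
import Data.Fin.Properties as F
open import Data.Fin.Subset using (Subset; _∈_; _∉_; ∣_∣)
open import Data.Fin.Subset.Properties using (p⊂q⇒∣p∣<∣q∣; ⊆⊤; ∈⊤; ∣⊤∣≡n)
open import Data.List using (List; []; _∷_; map; filter; allFin)
import Data.List as List
import Data.List.Properties as Listₚ
open import Data.Maybe using (just; nothing)
open import Data.Nat
  using (ℕ; zero; suc; _+_; _∸_; _≤_; _<_; _≤?_; _<ᵇ_; z≤n; s≤s; s≤s⁻¹)
open import Data.Nat.ListAction using (sum)
open import Data.Nat.Properties
  using (≤-reflexive; ≤-trans; ≤-antisym; ≤-<-trans; <⇒≤; <⇒≢; <⇒≱; ≮⇒≥; ≤∧≢⇒<;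
         m≤n⇒m<n∨m≡n; n≤1+n; 1+n≰n; <ᵇ-reflects-<; <-isStrictTotalOrder; +-suc;
         +-monoˡ-≤; +-monoʳ-≤; ∸-monoˡ-≤; m∸n+n≡m; m+n∸n≡m; [m+n]∸[m+o]≡n∸o;
         +-commutativeSemigroup; module ≤-Reasoning)
open import Data.Product using (Σ; ∃; _×_; _,_; proj₁; proj₂)
open import Data.Product.Relation.Binary.Lex.Strict using (×-isStrictTotalOrder)
open import Data.Product.Relation.Binary.Pointwise.NonDependent using (Pointwise)
open import Data.Sum using (_⊎_; inj₁; inj₂)
open import Data.Vec using (Vec; lookup; tabulate)
import Data.Vec.Properties as Vecₚ
open import Function using (_∘_; _on_; id; const)
open import Function.Bundles using (Injection; _⇔_; mk⇔; Equivalence)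
open import Function.Definitions using (Injective)
open import Function.Properties.Inverse using (↔⇒↣)
open import Level using (0ℓ)
open import Relation.Binary
  using (Rel; Transitive; Asymmetric; Trichotomous; tri<; tri≈; tri>; IsStrictTotalOrder)
import Relation.Binary.Construct.Flip.EqAndOrd as Flip
import Relation.Binary.Construct.On as On
open import Relation.Binary.PropositionalEquality
  using (_≡_; _≢_; refl; sym; trans; cong; cong₂; subst; subst₂; module ≡-Reasoning)
open import Relation.Nullary using (does; yes; no)
open import Relation.Nullary.Decidable using (dec-true)
open import Relation.Nullary.Negation using (contradiction)
open import Relation.Nullary.Reflects using (ofʸ; ofⁿ)
open import Relation.Unary using (Pred; Decidable)

-- Order the positions by i ≺ j iff p_i > p_j, or p_i = p_j and i < j.  This is a strict
-- total order, and π is an index permutation of m exactly when it lists the positions in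
-- ≺-increasing order; such a listing exists (invert the rank k ↦ |{x | x ≺ k}|) and is
-- unique (a strictly monotone permutation of Fin n is the identity).
--
-- For fixed π, the index condition at consecutive positions i, i+1 is equivalent to
-- p_{π(i)} ≥ p_{π(i+1)} + [π(i) > π(i+1)], since a tie is allowed exactly at an ascent.
-- As d_i(π) = [π(i) > π(i+1)] + d_{i+1}(π), these inequalities say precisely that
-- p_{π(i)} ≥ d_i(π) and that μ' = (p_{π(i)} − d_i(π))_i is weakly decreasing; conversely
-- every weakly decreasing μ̃ comes from the unique exponents p_{π(i)} = μ̃_i + d_i(π).

module _ {A B : Set} {_<₁_ : Rel A 0ℓ} {_<₂_ : Rel B 0ℓ}
         (compare : Trichotomous _≡_ _<₁_) (asym : Asymmetric _<₂_)
         (f : A → B) (mono : ∀ {x y} → x <₁ y → f x <₂ f y) where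

  strictlyMonotone⇒reflecting : ∀ {x y} → f x <₂ f y → x <₁ y
  strictlyMonotone⇒reflecting {x} {y} fx<fy with compare x y
  ... | tri< x<y _ _ = x<y
  ... | tri≈ _ refl _ = contradiction fx<fy (asym fx<fy)
  ... | tri> _ _ y<x = contradiction (mono y<x) (asym fx<fy)

  strictlyMonotone⇒injective : Injective _≡_ _≡_ f
  strictlyMonotone⇒injective {x} {y} fx≡fy with compare x y
  ... | tri< x<y _ _ = contradiction (subst (f x <₂_) (sym fx≡fy) (mono x<y)) (λ h → asym h h)
  ... | tri≈ _ x≡y _ = x≡y
  ... | tri> _ _ y<x = contradiction (subst (f y <₂_) fx≡fy (mono y<x)) (λ h → asym h h)

-- The domain is kept general so that the recursion can restrict f along inject₁.
strictlyMonotone⇒inflationary : ∀ {m n} (f : Fin m → Fin n) →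
  (∀ {i j} → i F.< j → f i F.< f j) → ∀ i → toℕ i ≤ toℕ (f i)
strictlyMonotone⇒inflationary f mono zero = z≤n
strictlyMonotone⇒inflationary f mono (suc i) = ≤-<-trans
  (strictlyMonotone⇒inflationary (f ∘ F.inject₁) (mono ∘ inject₁-mono) i)
  (mono (F.≤̄⇒inject₁< F.≤-refl))
  where
  inject₁-mono : ∀ {a b} → a F.< b → F.inject₁ a F.< F.inject₁ b
  inject₁-mono {a} {b} = subst₂ _<_ (sym (F.toℕ-inject₁ a)) (sym (F.toℕ-inject₁ b))

strictlyMonotone⇒≡id : ∀ {n} (τ : Permutation′ n) →
  (∀ {i j} → i F.< j → τ ⟨$⟩ʳ i F.< τ ⟨$⟩ʳ j) → ∀ i → τ ⟨$⟩ʳ i ≡ i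
strictlyMonotone⇒≡id τ mono i =
  F.toℕ-injective (≤-antisym τi≤i (strictlyMonotone⇒inflationary _ mono i))
  where
  inverse-mono : ∀ {i j} → i F.< j → τ ⟨$⟩ˡ i F.< τ ⟨$⟩ˡ j
  inverse-mono {i} {j} i<j =
    strictlyMonotone⇒reflecting {_<₂_ = F._<_} F.<-cmp F.<-asym (τ ⟨$⟩ʳ_) mono
      (subst₂ F._<_ (sym (inverseʳ τ {i})) (sym (inverseʳ τ {j})) i<j)
  τi≤i : toℕ (τ ⟨$⟩ʳ i) ≤ toℕ i
  τi≤i = subst (λ k → toℕ (τ ⟨$⟩ʳ i) ≤ toℕ k) (inverseˡ τ)
    (strictlyMonotone⇒inflationary _ inverse-mono (τ ⟨$⟩ʳ i))

strictlyMonotone-permutation-unique : ∀ {n} {_≺_ : Rel (Fin n) 0ℓ} → Asymmetric _≺_ →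
  (π σ : Permutation′ n) →
  (∀ {i j} → i F.< j → (π ⟨$⟩ʳ i) ≺ (π ⟨$⟩ʳ j)) →
  (∀ {i j} → i F.< j → (σ ⟨$⟩ʳ i) ≺ (σ ⟨$⟩ʳ j)) → π ≈ σ
strictlyMonotone-permutation-unique {_≺_ = _≺_} ≺-asym π σ π-mono σ-mono i = begin
  π ⟨$⟩ʳ i                        ≡⟨ inverseʳ σ ⟨
  σ ⟨$⟩ʳ (σ ⟨$⟩ˡ (π ⟨$⟩ʳ i))
    ≡⟨ cong (σ ⟨$⟩ʳ_) (strictlyMonotone⇒≡id (π ∘ₚ flip σ) τ-mono i) ⟩
  σ ⟨$⟩ʳ i                        ∎
  where
  open ≡-Reasoning
  τ-mono : ∀ {i j} → i F.< j → (π ∘ₚ flip σ) ⟨$⟩ʳ i F.< (π ∘ₚ flip σ) ⟨$⟩ʳ j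
  τ-mono i<j = strictlyMonotone⇒reflecting {_<₂_ = _≺_} F.<-cmp ≺-asym (σ ⟨$⟩ʳ_) σ-mono
    (subst₂ _≺_ (sym (inverseʳ σ)) (sym (inverseʳ σ)) (π-mono i<j))

injective⇒surjective : ∀ {n} (f : Fin n → Fin n) → Injective _≡_ _≡_ f →
  ∀ y → ∃ λ x → f x ≡ y
injective⇒surjective {suc n} f f-inj y with F.any? (λ x → f x F.≟ y)
... | yes hit = hit
... | no miss = contradiction (F.injective⇒≤ f-punchOut-inj) 1+n≰n
  where
  y≢f : ∀ x → y ≢ f x
  y≢f x y≡fx = miss (x , sym y≡fx)
  f-punchOut : Fin (suc n) → Fin n
  f-punchOut x = F.punchOut (y≢f x)
  f-punchOut-inj : Injective _≡_ _≡_ f-punchOut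
  f-punchOut-inj {x} {x′} = f-inj ∘ F.punchOut-injective (y≢f x) (y≢f x′)

injective⇒permutation : ∀ {n} (f : Fin n → Fin n) → Injective _≡_ _≡_ f → Permutation′ n
injective⇒permutation f f-inj =
  permutation f f⁻¹ (λ y → proj₂ (surj y)) (λ x → f-inj (proj₂ (surj (f x))))
  where
  surj : ∀ y → ∃ λ x → f x ≡ y
  surj = injective⇒surjective f f-inj
  f⁻¹ : Fin _ → Fin _
  f⁻¹ y = proj₁ (surj y)

>⊎≡×⇔≥×≡→ : ∀ {a b : ℕ} {Q : Set} →
  (b < a ⊎ (a ≡ b × Q)) ⇔ (b ≤ a × (a ≡ b → Q))
>⊎≡×⇔≥×≡→ {a} {b} {Q} = mk⇔ to from
  where
  to : b < a ⊎ (a ≡ b × Q) → b ≤ a × (a ≡ b → Q)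
  to (inj₁ b<a) = <⇒≤ b<a , λ a≡b → contradiction (sym a≡b) (<⇒≢ b<a)
  to (inj₂ (a≡b , q)) = ≤-reflexive (sym a≡b) , const q
  from : b ≤ a × (a ≡ b → Q) → b < a ⊎ (a ≡ b × Q)
  from (b≤a , tie⇒q) with m≤n⇒m<n∨m≡n b≤a
  ... | inj₁ b<a = inj₁ b<a
  ... | inj₂ b≡a = inj₂ (sym b≡a , tie⇒q (sym b≡a))

nextF≡just⇒toℕ≡suc : ∀ {n} {i j : Fin n} → nextF i ≡ just j → toℕ j ≡ suc (toℕ i)
nextF≡just⇒toℕ≡suc {suc (suc n)} {zero} refl = refl
nextF≡just⇒toℕ≡suc {suc (suc n)} {suc i} eq with nextF {suc n} i in e
nextF≡just⇒toℕ≡suc {suc (suc n)} {suc i} refl | just j = cong suc (nextF≡just⇒toℕ≡suc e)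

nextF≡nothing⇒last : ∀ {n} {i : Fin n} → nextF i ≡ nothing → suc (toℕ i) ≡ n
nextF≡nothing⇒last {suc zero} {zero} eq = refl
nextF≡nothing⇒last {suc (suc n)} {suc i} eq with nextF {suc n} i in e
... | nothing = cong suc (nextF≡nothing⇒last e)

backward-induction : ∀ {n} (P : Fin n → Set) →
  (∀ {i} → nextF i ≡ nothing → P i) →
  (∀ {i j} → nextF i ≡ just j → P j → P i) →
  ∀ i → P i
backward-induction {n} P last next i = go (n ∸ toℕ i) i (m∸n+n≡m (F.toℕ≤n i))
  where
  go : ∀ k i → k + toℕ i ≡ n → P i
  go zero i eq = contradiction eq (<⇒≢ (F.toℕ<n i))
  go (suc k) i eq with nextF i in e
  ... | nothing = last e
  ... | just j = next e (go k j (begin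
    k + toℕ j          ≡⟨ cong (k +_) (nextF≡just⇒toℕ≡suc e) ⟩
    k + suc (toℕ i)    ≡⟨ +-suc k (toℕ i) ⟩
    suc k + toℕ i      ≡⟨ eq ⟩
    n                  ∎))
    where open ≡-Reasoning

consecutive⇒< : ∀ {n} (R : Rel (Fin n) 0ℓ) → Transitive R →
  (∀ {i j} → nextF i ≡ just j → R i j) → ∀ {i j} → i F.< j → R i j
consecutive⇒< R R-trans R-step {i} =
  backward-induction (λ i → ∀ {j} → i F.< j → R i j) last next i
  where
  last : ∀ {i} → nextF i ≡ nothing → ∀ {j} → i F.< j → R i j
  last e {j} i<j =
    contradiction (subst (_≤ toℕ j) (nextF≡nothing⇒last e) i<j) (<⇒≱ (F.toℕ<n j))
  next : ∀ {i k} → nextF i ≡ just k →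
         (∀ {j} → k F.< j → R k j) → ∀ {j} → i F.< j → R i j
  next {i} e R-from-k {j} i<j
    with m≤n⇒m<n∨m≡n (subst (_≤ toℕ j) (sym (nextF≡just⇒toℕ≡suc e)) i<j)
  ... | inj₁ k<j = R-trans (R-step e) (R-from-k k<j)
  ... | inj₂ k≡j = subst (R i) (F.toℕ-injective k≡j) (R-step e)

consecutive⇒weaklyDecreasing : ∀ {n} (c : Fin n → ℕ) →
  (∀ {i j} → nextF i ≡ just j → c j ≤ c i) → WeaklyDecreasing (tabulate c)
consecutive⇒weaklyDecreasing c c-step i j i≤j
  rewrite Vecₚ.lookup∘tabulate c i | Vecₚ.lookup∘tabulate c j with m≤n⇒m<n∨m≡n i≤j
... | inj₁ i<j = consecutive⇒< (λ a b → c b ≤ c a) (λ ba cb → ≤-trans cb ba) c-step i<j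
... | inj₂ i≡j = ≤-reflexive (cong c (sym (F.toℕ-injective i≡j)))

filter-map : ∀ {A B : Set} {P : Pred B 0ℓ} (P? : Decidable P) (f : A → B) (xs : List A) →
  filter P? (map f xs) ≡ map f (filter (P? ∘ f) xs)
filter-map P? f [] = refl
filter-map P? f (x ∷ xs) with does (P? (f x))
... | true = cong (f x ∷_) (filter-map P? f xs)
... | false = filter-map P? f xs

suffixSum : ∀ {n} → (Fin n → ℕ) → ℕ → ℕ
suffixSum {n} f k = sum (map f (filter (λ j → k ≤? toℕ j) (allFin n)))

sum-map-filter-tabulate-suc : ∀ {n} (f : Fin (suc n) → ℕ) {P : Pred (Fin (suc n)) 0ℓ}
  (P? : Decidable P) →
  sum (map f (filter P? (List.tabulate suc))) ≡ sum (map (f ∘ suc) (filter (P? ∘ suc) (allFin n)))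
sum-map-filter-tabulate-suc {n} f P? = begin
  sum (map f (filter P? (List.tabulate suc)))
    ≡⟨ cong (sum ∘ map f ∘ filter P?) (Listₚ.map-tabulate id suc) ⟨
  sum (map f (filter P? (map suc (allFin n))))
    ≡⟨ cong (sum ∘ map f) (filter-map P? suc (allFin n)) ⟩
  sum (map f (map suc (filter (P? ∘ suc) (allFin n))))
    ≡⟨ cong sum (Listₚ.map-∘ (filter (P? ∘ suc) (allFin n))) ⟨
  sum (map (f ∘ suc) (filter (P? ∘ suc) (allFin n)))
    ∎
  where open ≡-Reasoning

suffixSum-suc : ∀ {n} (f : Fin (suc n) → ℕ) k → suffixSum f (suc k) ≡ suffixSum (f ∘ suc) k
suffixSum-suc {n} f k = trans (sum-map-filter-tabulate-suc f (λ j → suc k ≤? toℕ j))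
  (cong (sum ∘ map (f ∘ suc)) (Listₚ.filter-≐ _ _ (s≤s⁻¹ , s≤s) (allFin n)))

suffixSum-zero : ∀ {n} (f : Fin (suc n) → ℕ) → suffixSum f 0 ≡ f zero + suffixSum (f ∘ suc) 0
suffixSum-zero {n} f = cong (f zero +_)
  (trans (sum-map-filter-tabulate-suc f (λ j → 0 ≤? toℕ j))
         (cong (sum ∘ map (f ∘ suc))
               (Listₚ.filter-≐ _ _ (const z≤n , const z≤n) (allFin n))))

suffixSum-step : ∀ {n} (f : Fin n → ℕ) (i : Fin n) →
  suffixSum f (toℕ i) ≡ f i + suffixSum f (suc (toℕ i))
suffixSum-step f zero = trans (suffixSum-zero f) (cong (f zero +_) (sym (suffixSum-suc f 0)))
suffixSum-step f (suc i) = begin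
  suffixSum f (suc (toℕ i))                      ≡⟨ suffixSum-suc f (toℕ i) ⟩
  suffixSum (f ∘ suc) (toℕ i)                    ≡⟨ suffixSum-step (f ∘ suc) i ⟩
  f (suc i) + suffixSum (f ∘ suc) (suc (toℕ i))  ≡⟨ cong (f (suc i) +_) (suffixSum-suc f _) ⟨
  f (suc i) + suffixSum f (suc (suc (toℕ i)))    ∎
  where open ≡-Reasoning

suffixSum-end : ∀ n (f : Fin n → ℕ) → suffixSum f n ≡ 0
suffixSum-end zero f = refl
suffixSum-end (suc n) f = trans (suffixSum-suc f n) (suffixSum-end n (f ∘ suc))

descent-just : ∀ {n} (π : Sym n) {i j : Fin n} → nextF i ≡ just j →
  descent π i ≡ (if toℕ (π ⟨$⟩ʳ j) <ᵇ toℕ (π ⟨$⟩ʳ i) then 1 else 0)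
descent-just π {i} e with nextF i
descent-just π refl | just _ = refl

descent-nothing : ∀ {n} (π : Sym n) {i : Fin n} → nextF i ≡ nothing → descent π i ≡ 0
descent-nothing π {i} e with nextF i
descent-nothing π refl | nothing = refl

descent-cases : ∀ {n} (π : Sym n) {i j : Fin n} → nextF i ≡ just j →
  (descent π i ≡ 1 × π ⟨$⟩ʳ j F.< π ⟨$⟩ʳ i) ⊎
  (descent π i ≡ 0 × π ⟨$⟩ʳ i F.< π ⟨$⟩ʳ j)
descent-cases π {i} {j} e rewrite descent-just π e
  with toℕ (π ⟨$⟩ʳ j) <ᵇ toℕ (π ⟨$⟩ʳ i)
     | <ᵇ-reflects-< (toℕ (π ⟨$⟩ʳ j)) (toℕ (π ⟨$⟩ʳ i))
... | true  | ofʸ πj<πi = inj₁ (refl , πj<πi)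
... | false | ofⁿ πj≮πi =
  inj₂ (refl , F.≤∧≢⇒< (≮⇒≥ πj≮πi) (i≢j ∘ Injection.injective (↔⇒↣ π)))
  where
  i≢j : i ≢ j
  i≢j refl = 1+n≰n (≤-reflexive (sym (nextF≡just⇒toℕ≡suc e)))

d-step : ∀ {n} (π : Sym n) {i j : Fin n} → nextF i ≡ just j → d π i ≡ descent π i + d π j
d-step π {i} e = trans (suffixSum-step (descent π) i)
  (cong (λ k → descent π i + suffixSum (descent π) k) (sym (nextF≡just⇒toℕ≡suc e)))

d-last : ∀ {n} (π : Sym n) {i : Fin n} → nextF i ≡ nothing → d π i ≡ 0
d-last {n} π {i} e = begin
  d π i                                              ≡⟨ suffixSum-step (descent π) i ⟩
  descent π i + suffixSum (descent π) (suc (toℕ i))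
    ≡⟨ cong₂ _+_ (descent-nothing π e) (cong (suffixSum (descent π)) (nextF≡nothing⇒last e)) ⟩
  suffixSum (descent π) n                            ≡⟨ suffixSum-end n (descent π) ⟩
  0                                                  ∎
  where open ≡-Reasoning

module IndexOrder {n} (m : Monomial n) where

  key : Fin n → ℕ × Fin n
  key k = lookup m k , k

  infix 4 _≺_
  _≺_ : Rel (Fin n) 0ℓ
  a ≺ b = lookup m b < lookup m a ⊎ (lookup m a ≡ lookup m b × a F.< b)

  -- _≺_ is, definitionally, the lexicographic order on key with exponents compared by _>_.
  ≺-isStrictTotalOrder : IsStrictTotalOrder (Pointwise _≡_ _≡_ on key) _≺_
  ≺-isStrictTotalOrder = On.isStrictTotalOrder key
    (×-isStrictTotalOrder (Flip.isStrictTotalOrder <-isStrictTotalOrder)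
                          F.<-isStrictTotalOrder)

  open IsStrictTotalOrder ≺-isStrictTotalOrder
    using () renaming (trans to ≺-trans; asym to ≺-asym; irrefl to ≺-irrefl; _<?_ to _≺?_)

  ≺-cmp : Trichotomous _≡_ _≺_
  ≺-cmp a b with IsStrictTotalOrder.compare ≺-isStrictTotalOrder a b
  ... | tri< a≺b a≉b b⊀a = tri< a≺b (λ { refl → a≉b (refl , refl) }) b⊀a
  ... | tri≈ a⊀b (_ , a≡b) b⊀a = tri≈ a⊀b a≡b b⊀a
  ... | tri> a⊀b a≉b b≺a = tri> a⊀b (λ { refl → a≉b (refl , refl) }) b≺a

  isIndexPerm⇔≺-consecutive : ∀ (π : Sym n) →
    IsIndexPerm m π ⇔ (∀ {i j} → nextF i ≡ just j → π ⟨$⟩ʳ i ≺ π ⟨$⟩ʳ j)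
  isIndexPerm⇔≺-consecutive π = mk⇔
    (λ idx {i} {j} e → Equivalence.from >⊎≡×⇔≥×≡→ (idx i j e))
    (λ ≺-step i j e → Equivalence.to >⊎≡×⇔≥×≡→ (≺-step e))

  isIndexPerm⇒≺-monotone : ∀ (π : Sym n) → IsIndexPerm m π →
    ∀ {i j} → i F.< j → π ⟨$⟩ʳ i ≺ π ⟨$⟩ʳ j
  isIndexPerm⇒≺-monotone π idx =
    consecutive⇒< (λ i j → π ⟨$⟩ʳ i ≺ π ⟨$⟩ʳ j) ≺-trans
      (Equivalence.to (isIndexPerm⇔≺-consecutive π) idx)

  isIndexPerm-unique : ∀ (π σ : Sym n) → IsIndexPerm m π → IsIndexPerm m σ → π ≈ σ
  isIndexPerm-unique π σ idx-π idx-σ =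
    strictlyMonotone-permutation-unique {_≺_ = _≺_} ≺-asym π σ
      (isIndexPerm⇒≺-monotone π idx-π) (isIndexPerm⇒≺-monotone σ idx-σ)

  predecessors : Fin n → Subset n
  predecessors k = tabulate (λ x → does (x ≺? k))

  ∈-predecessors⇔ : ∀ {x k} → x ∈ predecessors k ⇔ x ≺ k
  ∈-predecessors⇔ {x} {k} = mk⇔ to from
    where
    to : x ∈ predecessors k → x ≺ k
    to x∈ with x ≺? k | trans (sym (Vecₚ.lookup∘tabulate _ x)) (Vecₚ.[]=⇒lookup x∈)
    ... | yes x≺k | _ = x≺k
    ... | no _ | ()
    from : x ≺ k → x ∈ predecessors k
    from x≺k =
      Vecₚ.lookup⇒[]= x _ (trans (Vecₚ.lookup∘tabulate _ x) (dec-true (x ≺? k) x≺k))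

  ∉-predecessors : ∀ k → k ∉ predecessors k
  ∉-predecessors k = ≺-irrefl (refl , refl) ∘ Equivalence.to ∈-predecessors⇔

  rank : Fin n → Fin n
  rank k = F.fromℕ< (subst (∣ predecessors k ∣ <_) (∣⊤∣≡n n)
    (p⊂q⇒∣p∣<∣q∣ (⊆⊤ , k , ∈⊤ , ∉-predecessors k)))

  rank-monotone : ∀ {a b} → a ≺ b → rank a F.< rank b
  rank-monotone {a} {b} a≺b = subst₂ _<_ (sym (F.toℕ-fromℕ< _)) (sym (F.toℕ-fromℕ< _))
    (p⊂q⇒∣p∣<∣q∣
      (predecessors-⊆ , a , Equivalence.from ∈-predecessors⇔ a≺b , ∉-predecessors a))
    where
    predecessors-⊆ : ∀ {x} → x ∈ predecessors a → x ∈ predecessors b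
    predecessors-⊆ x∈ =
      Equivalence.from ∈-predecessors⇔ (≺-trans (Equivalence.to ∈-predecessors⇔ x∈) a≺b)

  sortingPerm : Sym n
  sortingPerm = flip (injective⇒permutation rank
    (strictlyMonotone⇒injective {_<₂_ = F._<_} ≺-cmp F.<-asym rank rank-monotone))

  sortingPerm-isIndexPerm : IsIndexPerm m sortingPerm
  sortingPerm-isIndexPerm =
    Equivalence.from (isIndexPerm⇔≺-consecutive sortingPerm) λ e →
    strictlyMonotone⇒reflecting {_<₂_ = F._<_} ≺-cmp F.<-asym rank rank-monotone
      (subst₂ F._<_ (sym (inverseˡ sortingPerm)) (sym (inverseˡ sortingPerm))
        (≤-reflexive (sym (nextF≡just⇒toℕ≡suc e))))

permutedExponent : ∀ {n} → Monomial n → Sym n → Fin n → ℕ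
permutedExponent m π i = lookup m (π ⟨$⟩ʳ i)

DescentGap : ∀ {n} → Monomial n → Sym n → Set
DescentGap m π = ∀ {i j} → nextF i ≡ just j →
  descent π i + permutedExponent m π j ≤ permutedExponent m π i

isIndexPerm⇔descentGap : ∀ {n} (m : Monomial n) (π : Sym n) → IsIndexPerm m π ⇔ DescentGap m π
isIndexPerm⇔descentGap m π =
  mk⇔ (λ idx {i} {j} e → to (idx i j e) e) (λ gap i j e → from (gap e) e)
  where
  p : Fin _ → ℕ
  p = permutedExponent m π
  to : ∀ {i j} → p j ≤ p i × (p i ≡ p j → π ⟨$⟩ʳ i F.< π ⟨$⟩ʳ j) →
       nextF i ≡ just j →
       descent π i + p j ≤ p i
  to (pj≤pi , tie⇒ascent) e with descent-cases π e
  ... | inj₁ (δ≡1 , πj<πi) rewrite δ≡1 =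
    ≤∧≢⇒< pj≤pi (λ pj≡pi → F.<-asym (tie⇒ascent (sym pj≡pi)) πj<πi)
  ... | inj₂ (δ≡0 , _) rewrite δ≡0 = pj≤pi
  from : ∀ {i j} → descent π i + p j ≤ p i → nextF i ≡ just j →
         p j ≤ p i × (p i ≡ p j → π ⟨$⟩ʳ i F.< π ⟨$⟩ʳ j)
  from {i} {j} gap e with descent-cases π e
  ... | inj₁ (δ≡1 , _) = <⇒≤ pj<pi , λ pi≡pj → contradiction (sym pi≡pj) (<⇒≢ pj<pi)
    where
    pj<pi : p j < p i
    pj<pi = subst (λ δ → δ + p j ≤ p i) δ≡1 gap
  ... | inj₂ (δ≡0 , πi<πj) = subst (λ δ → δ + p j ≤ p i) δ≡0 gap , const πi<πj

d≤permutedExponent : ∀ {n} (m : Monomial n) (π : Sym n) → DescentGap m π →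
  ∀ i → d π i ≤ permutedExponent m π i
d≤permutedExponent m π gap = backward-induction (λ i → d π i ≤ permutedExponent m π i)
  (λ e → ≤-trans (≤-reflexive (d-last π e)) z≤n)
  (λ {i} {j} e d≤j → begin
    d π i                                 ≡⟨ d-step π e ⟩
    descent π i + d π j                   ≤⟨ +-monoʳ-≤ (descent π i) d≤j ⟩
    descent π i + permutedExponent m π j  ≤⟨ gap e ⟩
    permutedExponent m π i                ∎)
  where open ≤-Reasoning

conjMu-weaklyDecreasing : ∀ {n} (m : Monomial n) (π : Sym n) → DescentGap m π →
  WeaklyDecreasing (conjMu m π)
conjMu-weaklyDecreasing m π gap = consecutive⇒weaklyDecreasing _ λ {i} {j} e → begin
  p j ∸ d π j                                  ≡⟨ [m+n]∸[m+o]≡n∸o (descent π i) _ _ ⟨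
  (descent π i + p j) ∸ (descent π i + d π j)  ≤⟨ ∸-monoˡ-≤ (descent π i + d π j) (gap e) ⟩
  p i ∸ (descent π i + d π j)                  ≡⟨ cong (p i ∸_) (d-step π e) ⟨
  p i ∸ d π i                                  ∎
  where
  open ≤-Reasoning
  p : Fin _ → ℕ
  p = permutedExponent m π

permutedExponent≡conjMu+d : ∀ {n} (m : Monomial n) (π : Sym n) → DescentGap m π →
  ∀ i → permutedExponent m π i ≡ lookup (conjMu m π) i + d π i
permutedExponent≡conjMu+d m π gap i = begin
  permutedExponent m π i                  ≡⟨ m∸n+n≡m (d≤permutedExponent m π gap i) ⟨
  permutedExponent m π i ∸ d π i + d π i  ≡⟨ cong (_+ d π i) (Vecₚ.lookup∘tabulate _ i) ⟨
  lookup (conjMu m π) i + d π i           ∎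
  where open ≡-Reasoning

fromConjMu : ∀ {n} → Sym n → Vec ℕ n → Monomial n
fromConjMu π μ = tabulate (λ k → lookup μ (π ⟨$⟩ˡ k) + d π (π ⟨$⟩ˡ k))

permutedExponent-fromConjMu : ∀ {n} (π : Sym n) (μ : Vec ℕ n) i →
  permutedExponent (fromConjMu π μ) π i ≡ lookup μ i + d π i
permutedExponent-fromConjMu π μ i =
  trans (Vecₚ.lookup∘tabulate _ (π ⟨$⟩ʳ i))
        (cong (λ k → lookup μ k + d π k) (inverseˡ π))

conjMu-fromConjMu : ∀ {n} (π : Sym n) (μ : Vec ℕ n) → conjMu (fromConjMu π μ) π ≡ μ
conjMu-fromConjMu π μ = trans
  (Vecₚ.tabulate-cong λ i →
    trans (cong (_∸ d π i) (permutedExponent-fromConjMu π μ i))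
          (m+n∸n≡m (lookup μ i) (d π i)))
  (Vecₚ.tabulate∘lookup μ)

fromConjMu-descentGap : ∀ {n} (π : Sym n) (μ : Vec ℕ n) → WeaklyDecreasing μ →
  DescentGap (fromConjMu π μ) π
fromConjMu-descentGap π μ μ-decreasing {i} {j} e = begin
  descent π i + p j                   ≡⟨ cong (_ +_) (permutedExponent-fromConjMu π μ j) ⟩
  descent π i + (lookup μ j + d π j)
    ≡⟨ x∙yz≈y∙xz +-commutativeSemigroup (descent π i) (lookup μ j) (d π j) ⟩
  lookup μ j + (descent π i + d π j)  ≤⟨ +-monoˡ-≤ _ (μ-decreasing i j i≤j) ⟩
  lookup μ i + (descent π i + d π j)  ≡⟨ cong (lookup μ i +_) (d-step π e) ⟨
  lookup μ i + d π i                  ≡⟨ permutedExponent-fromConjMu π μ i ⟨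
  p i                                 ∎
  where
  open ≤-Reasoning
  p : Fin _ → ℕ
  p = permutedExponent (fromConjMu π μ) π
  i≤j : toℕ i ≤ toℕ j
  i≤j = subst (toℕ i ≤_) (sym (nextF≡just⇒toℕ≡suc e)) (n≤1+n (toℕ i))

fromConjMu-conjMu : ∀ {n} (m : Monomial n) (π : Sym n) → DescentGap m π →
  fromConjMu π (conjMu m π) ≡ m
fromConjMu-conjMu m π gap = trans
  (Vecₚ.tabulate-cong λ k → begin
    lookup (conjMu m π) (π ⟨$⟩ˡ k) + d π (π ⟨$⟩ˡ k)
      ≡⟨ permutedExponent≡conjMu+d m π gap (π ⟨$⟩ˡ k) ⟨
    lookup m (π ⟨$⟩ʳ (π ⟨$⟩ˡ k))
      ≡⟨ cong (lookup m) (inverseʳ π) ⟩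
    lookup m k
      ∎)
  (Vecₚ.tabulate∘lookup m)
  where open ≡-Reasoning

lemma6p3 : ∀ (n : ℕ) →
    -- π(m) exists and is unique (so m ↦ (π(m), μ(m)') is a well-defined map)
    ((m : Monomial n) →
      Σ (Sym n) (IsIndexPerm m) ×
      (∀ (π σ : Sym n) → IsIndexPerm m π → IsIndexPerm m σ →
        ∀ (i : Fin n) → π ⟨$⟩ʳ i ≡ σ ⟨$⟩ʳ i)) ×
    -- μ(m)' is a partition with at most n parts
    ((m : Monomial n) (π : Sym n) → IsIndexPerm m π → WeaklyDecreasing (conjMu m π)) ×
    -- every pair (π, μ̃) has exactly one preimage
    ((π : Sym n) (μ : Vec ℕ n) → WeaklyDecreasing μ →
      Σ (Monomial n) (λ m → (IsIndexPerm m π × conjMu m π ≡ μ) ×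
        (∀ (m′ : Monomial n) → IsIndexPerm m′ π → conjMu m′ π ≡ μ → m′ ≡ m)))
lemma6p3 n =
    (λ m → (sortingPerm m , sortingPerm-isIndexPerm m) , isIndexPerm-unique m)
  , (λ m π idx → conjMu-weaklyDecreasing m π (toGap m π idx))
  , λ π μ μ-decreasing →
      fromConjMu π μ
    , ( fromGap (fromConjMu π μ) π (fromConjMu-descentGap π μ μ-decreasing)
      , conjMu-fromConjMu π μ)
    , λ m′ idx conjMu≡μ →
        trans (sym (fromConjMu-conjMu m′ π (toGap m′ π idx))) (cong (fromConjMu π) conjMu≡μ)
  where
  open IndexOrder using (sortingPerm; sortingPerm-isIndexPerm; isIndexPerm-unique)
  toGap : ∀ (m : Monomial n) π → IsIndexPerm m π → DescentGap m π
  toGap m π = Equivalence.to (isIndexPerm⇔descentGap m π)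
  fromGap : ∀ (m : Monomial n) π → DescentGap m π → IsIndexPerm m π
  fromGap m π = Equivalence.from (isIndexPerm⇔descentGap m π)
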